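{- (Soundness of PRHL.) If a partial reverse Hoare triple $\{P\}\,C\,\{Q\}$ is provable in PRHL, then it is valid.
   Context: Programs, assertions and semantics: states $\sigma:\mathrm{Var}\to\mathbb{N}$; expressions $E ::= x\mid n\mid f(E,\dots,E)$; Boolean conditions $B ::= Q(E,\dots,E)\mid E=E\mid E\le E\mid\neg B\mid B\wedge B\mid B\vee B$; programs $C ::= \varepsilon\mid C'$, $C' ::= x:=E\mid C';C'\mid\mathtt{while}\ B\ \mathtt{do}\ C\mid C\ \mathtt{or}\ C$ ($\varepsilon$ the empty program; $C_0;C_1$ denotes $C_i$ when $C_{1-i}=\varepsilon$); assertions are first-order formulas over Boolean conditions with $\neg,\vee,\wedge,\to,\exists,\forall$, interpreted over $\mathbb{N}$ ($\sigma\models P$); $P\models Q$ means every state satisfying $P$ satisfies $Q$; $Q[x:=E]$ denotes substitution of $E$ for free $x$. Small-step semantics: $\langle x:=E,\sigma\rangle\to\langle\varepsilon,\sigma[x\mapsto[\![E]\!]\sigma]\rangle$; $\langle\mathtt{while}\ B\ \mathtt{do}\ C,\sigma\rangle\to\langle C;\mathtt{while}\ B\ \mathtt{do}\ C,\sigma\rangle$ if $B$ holds in $\sigma$, else $\to\langle\varepsilon,\sigma\rangle$; $\langle C_0;C_1,\sigma\rangle\to\langle C_0';C_1,\sigma'\rangle$ if $\langle C_0,\sigma\rangle\to\langle C_0',\sigma'\rangle$; $\langle C_0\ \mathtt{or}\ C_1,\sigma\rangle\to\langle C_i,\sigma\rangle$ ($i=0,1$); $\to^{*}$ the reflexive-transitive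 closure. A triple $\{P\}\,C\,\{Q\}$ is valid if for all $\sigma'\models Q$ and all $\sigma$ with $\langle C,\sigma\rangle\to^{*}\langle\varepsilon,\sigma'\rangle$, $\sigma\models P$. PRHL is the proof system whose proofs are finite derivation trees built from the rules: (Axiom) $\{Q\}\,\varepsilon\,\{Q\}$; (Assign) $\{Q[x:=E]\}\,x:=E\,\{Q\}$; (Seq) from $\{P\}C_0\{R\}$ and $\{R\}C_1\{Q\}$ infer $\{P\}C_0;C_1\{Q\}$; (Cons) from $\{P\}C\{Q\}$ infer $\{P'\}C\{Q'\}$ provided $P\models P'$ and $Q'\models Q$; (Or) from $\{P\}C_0\{Q\}$ and $\{P\}C_1\{Q\}$ infer $\{P\}C_0\ \mathtt{or}\ C_1\{Q\}$; (While) from $\{B\to P\}C\{P\}$ infer $\{P\}\,\mathtt{while}\ B\ \mathtt{do}\ C\,\{\neg B\to P\}$. Every leaf must be an instance of Axiom or Assign. -}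

module Defs where

open import Data.Nat using (ℕ; _≤_)
open import Data.Nat.Properties using (_≟_)
open import Data.Fin using (Fin; zero; suc)
open import Data.Vec using (Vec; []; _∷_)
open import Data.Product using (_×_; Σ; _,_)
open import Data.Sum using (_⊎_)
open import Data.Empty using (⊥)
open import Relation.Nullary using (¬_; yes; no)
open import Relation.Binary.PropositionalEquality using (_≡_)

Var : Set
Var = ℕ

State : Set
State = Var → ℕ

update : State → Var → ℕ → State
update σ x v y with y ≟ x
... | yes _ = v
... | no  _ = σ y

record Sig : Set₁ where
  field
    Fun    : Set
    farity : Fun → ℕ
    Pred   : Set
    parity : Pred → ℕ
open Sig public

record Interp (S : Sig) : Set₁ where
  field
    funI  : (f : Fun S) → Vec ℕ (farity S f) → ℕ
    predI : (q : Pred S) → Vec ℕ (parity S q) → Set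
open Interp public

module _ (S : Sig) where

  data Expr : Set where
    var : Var → Expr
    num : ℕ → Expr
    app : (f : Fun S) → Vec Expr (farity S f) → Expr

  data BExp : Set where
    pred  : (q : Pred S) → Vec Expr (parity S q) → BExp
    _==_  : Expr → Expr → BExp
    _<=_  : Expr → Expr → BExp
    bnot  : BExp → BExp
    band  : BExp → BExp → BExp
    bor   : BExp → BExp → BExp

  mutual
    data Prog : Set where
      ε   : Prog
      cmd : Cmd → Prog

    data Cmd : Set where
      _:=_    : Var → Expr → Cmd
      _⨾_     : Cmd → Cmd → Cmd
      while   : BExp → Prog → Cmd
      _or_    : Prog → Prog → Cmd

  _；_ : Prog → Prog → Prog
  ε ； C = C
  cmd c ； ε = cmd c
  cmd c ； cmd d = cmd (c ⨾ d)

  -- Bound (quantified) variables are de Bruijn indices (Fin n); free variables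
  -- are program variables.  Substitution of a program expression for a free
  -- variable is therefore automatically capture-avoiding.
  data Term (n : ℕ) : Set where
    fvar : Var → Term n
    bvar : Fin n → Term n
    tnum : ℕ → Term n
    tapp : (f : Fun S) → Vec (Term n) (farity S f) → Term n

  data Assn (n : ℕ) : Set where
    apred : (q : Pred S) → Vec (Term n) (parity S q) → Assn n
    _≐_   : Term n → Term n → Assn n
    _≦_   : Term n → Term n → Assn n
    ¬ₐ_   : Assn n → Assn n
    _∨ₐ_  : Assn n → Assn n → Assn n
    _∧ₐ_  : Assn n → Assn n → Assn n
    _⇒ₐ_  : Assn n → Assn n → Assn n
    ∃ₐ    : Assn (ℕ.suc n) → Assn n
    ∀ₐ    : Assn (ℕ.suc n) → Assn n

  mutual
    toTerm : ∀ {n} → Expr → Term n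
    toTerm (var x) = fvar x
    toTerm (num k) = tnum k
    toTerm (app f es) = tapp f (toTerms es)

    toTerms : ∀ {n k} → Vec Expr k → Vec (Term n) k
    toTerms [] = []
    toTerms (e ∷ es) = toTerm e ∷ toTerms es

  toAssn : ∀ {n} → BExp → Assn n
  toAssn (pred q es) = apred q (toTerms es)
  toAssn (a == b) = toTerm a ≐ toTerm b
  toAssn (a <= b) = toTerm a ≦ toTerm b
  toAssn (bnot b) = ¬ₐ toAssn b
  toAssn (band a b) = toAssn a ∧ₐ toAssn b
  toAssn (bor a b) = toAssn a ∨ₐ toAssn b

  mutual
    substT : ∀ {n} → Term n → Var → Expr → Term n
    substT (fvar y) x E with y ≟ x
    ... | yes _ = toTerm E
    ... | no  _ = fvar y
    substT (bvar i) x E = bvar i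
    substT (tnum k) x E = tnum k
    substT (tapp f ts) x E = tapp f (substTs ts x E)

    substTs : ∀ {n k} → Vec (Term n) k → Var → Expr → Vec (Term n) k
    substTs [] x E = []
    substTs (t ∷ ts) x E = substT t x E ∷ substTs ts x E

  _[_:=_] : ∀ {n} → Assn n → Var → Expr → Assn n
  apred q ts [ x := E ] = apred q (substTs ts x E)
  (a ≐ b) [ x := E ] = substT a x E ≐ substT b x E
  (a ≦ b) [ x := E ] = substT a x E ≦ substT b x E
  (¬ₐ P) [ x := E ] = ¬ₐ (P [ x := E ])
  (P ∨ₐ Q) [ x := E ] = (P [ x := E ]) ∨ₐ (Q [ x := E ])
  (P ∧ₐ Q) [ x := E ] = (P [ x := E ]) ∧ₐ (Q [ x := E ])
  (P ⇒ₐ Q) [ x := E ] = (P [ x := E ]) ⇒ₐ (Q [ x := E ])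
  ∃ₐ P [ x := E ] = ∃ₐ (P [ x := E ])
  ∀ₐ P [ x := E ] = ∀ₐ (P [ x := E ])

  Assertion : Set
  Assertion = Assn 0

module _ {S : Sig} (I : Interp S) where

  mutual
    ⟦_⟧ : Expr S → State → ℕ
    ⟦ var x ⟧ σ = σ x
    ⟦ num k ⟧ σ = k
    ⟦ app f es ⟧ σ = funI I f (⟦ es ⟧* σ)

    ⟦_⟧* : ∀ {k} → Vec (Expr S) k → State → Vec ℕ k
    ⟦ [] ⟧* σ = []
    ⟦ e ∷ es ⟧* σ = ⟦ e ⟧ σ ∷ ⟦ es ⟧* σ

  holds : BExp S → State → Set
  holds (pred q es) σ = predI I q (⟦ es ⟧* σ)
  holds (a == b) σ = ⟦ a ⟧ σ ≡ ⟦ b ⟧ σ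
  holds (a <= b) σ = ⟦ a ⟧ σ ≤ ⟦ b ⟧ σ
  holds (bnot b) σ = ¬ holds b σ
  holds (band a b) σ = holds a σ × holds b σ
  holds (bor a b) σ = holds a σ ⊎ holds b σ

  extend : ∀ {n} → (Fin n → ℕ) → ℕ → Fin (ℕ.suc n) → ℕ
  extend ρ v zero = v
  extend ρ v (suc i) = ρ i

  mutual
    evalT : ∀ {n} → Term S n → State → (Fin n → ℕ) → ℕ
    evalT (fvar x) σ ρ = σ x
    evalT (bvar i) σ ρ = ρ i
    evalT (tnum k) σ ρ = k
    evalT (tapp f ts) σ ρ = funI I f (evalTs ts σ ρ)

    evalTs : ∀ {n k} → Vec (Term S n) k → State → (Fin n → ℕ) → Vec ℕ k
    evalTs [] σ ρ = []
    evalTs (t ∷ ts) σ ρ = evalT t σ ρ ∷ evalTs ts σ ρ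

  sat : ∀ {n} → State → (Fin n → ℕ) → Assn S n → Set
  sat σ ρ (apred q ts) = predI I q (evalTs ts σ ρ)
  sat σ ρ (a ≐ b) = evalT a σ ρ ≡ evalT b σ ρ
  sat σ ρ (a ≦ b) = evalT a σ ρ ≤ evalT b σ ρ
  sat σ ρ (¬ₐ P) = ¬ sat σ ρ P
  sat σ ρ (P ∨ₐ Q) = sat σ ρ P ⊎ sat σ ρ Q
  sat σ ρ (P ∧ₐ Q) = sat σ ρ P × sat σ ρ Q
  sat σ ρ (P ⇒ₐ Q) = sat σ ρ P → sat σ ρ Q
  sat σ ρ (∃ₐ P) = Σ ℕ λ v → sat σ (extend ρ v) P
  sat σ ρ (∀ₐ P) = (v : ℕ) → sat σ (extend ρ v) P

  noBound : Fin 0 → ℕ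
  noBound ()

  _⊨_ : State → Assertion S → Set
  σ ⊨ P = sat σ noBound P

  _⊨ₑ_ : Assertion S → Assertion S → Set
  P ⊨ₑ Q = ∀ σ → σ ⊨ P → σ ⊨ Q

  data _⟶_ : Prog S × State → Prog S × State → Set where
    step-assign : ∀ {x E σ} →
      (cmd (x := E) , σ) ⟶ (ε , update σ x (⟦ E ⟧ σ))
    step-while-true : ∀ {B C σ} → holds B σ →
      (cmd (while B C) , σ) ⟶ ((_；_ S C (cmd (while B C))) , σ)
    step-while-false : ∀ {B C σ} → ¬ holds B σ →
      (cmd (while B C) , σ) ⟶ (ε , σ)
    step-seq : ∀ {c₀ c₁ C₀' σ σ'} →
      (cmd c₀ , σ) ⟶ (C₀' , σ') →
      (cmd (c₀ ⨾ c₁) , σ) ⟶ (_；_ S C₀' (cmd c₁) , σ')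
    step-or₀ : ∀ {C₀ C₁ σ} → (cmd (C₀ or C₁) , σ) ⟶ (C₀ , σ)
    step-or₁ : ∀ {C₀ C₁ σ} → (cmd (C₀ or C₁) , σ) ⟶ (C₁ , σ)

  data _⟶*_ : Prog S × State → Prog S × State → Set where
    refl* : ∀ {c} → c ⟶* c
    step* : ∀ {c d e} → c ⟶ d → d ⟶* e → c ⟶* e

  Valid : Assertion S → Prog S → Assertion S → Set
  Valid P C Q = ∀ σ' → σ' ⊨ Q → ∀ σ → (C , σ) ⟶* (ε , σ') → σ ⊨ P

  data PRHL : Assertion S → Prog S → Assertion S → Set where
    axiom  : ∀ {Q} → PRHL Q ε Q
    assign : ∀ {Q x E} → PRHL (_[_:=_] S Q x E) (cmd (x := E)) Q
    seq    : ∀ {P R Q C₀ C₁} → PRHL P C₀ R → PRHL R C₁ Q →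
             PRHL P (_；_ S C₀ C₁) Q
    cons   : ∀ {P P' Q Q' C} → PRHL P C Q → P ⊨ₑ P' → Q' ⊨ₑ Q →
             PRHL P' C Q'
    or     : ∀ {P Q C₀ C₁} → PRHL P C₀ Q → PRHL P C₁ Q →
             PRHL P (cmd (C₀ or C₁)) Q
    while  : ∀ {B P C} → PRHL (toAssn S B ⇒ₐ P) C P →
             PRHL P (cmd (while B C)) ((¬ₐ toAssn S B) ⇒ₐ P)

{-# OPTIONS --safe #-}
-- Assign is sound because satisfying Q[x := E] in σ
-- means satisfying Q in σ[x ↦ ⟦E⟧σ]. A terminating run of C₀ ; C₁ splits at the
-- first moment C₀ is used up into a run of C₀ and a run of C₁ no longer than the
-- whole, which gives Seq; for While the run after one unrolling and one pass
-- through the body is strictly shorter, so the invariant propagates backwards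
-- by well-founded induction on the length of the run.
module Submission where

open import Defs hiding (⟦_⟧; _⊨_; _⊨ₑ_; _；_; _[_:=_])
import Defs
open import Data.Nat using (ℕ; zero; suc; _≤_; _<_; z≤n; s≤s)
open import Data.Nat.Properties using (_≟_; ≤-refl; m≤n⇒m≤1+n)
open import Data.Nat.Induction using (<-wellFounded)
open import Induction.WellFounded using (Acc; acc)
open import Data.Fin using (Fin)
open import Data.Vec using (Vec; []; _∷_)
open import Data.Product using (Σ; _×_; _,_; map₂)
open import Data.Product.Function.NonDependent.Propositional using (_×-⇔_)
open import Data.Sum.Function.Propositional using (_⊎-⇔_)
open import Function using (_⇔_; mk⇔; Equivalence; _∘_)
open import Function.Related.Propositional using (≡⇒; equivalence)
open import Function.Related.TypeIsomorphisms using (¬-cong-⇔; →-cong-⇔)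
open import Relation.Nullary using (yes; no)
open import Relation.Binary.PropositionalEquality using (_≡_; refl; cong; cong₂)

open Equivalence using (to; from)

≡⇒⇔ : {A B : Set} → A ≡ B → A ⇔ B
≡⇒⇔ = ≡⇒ {k = equivalence}

Σ-cong-⇔ : {A : Set} {B C : A → Set} → (∀ x → B x ⇔ C x) → Σ A B ⇔ Σ A C
Σ-cong-⇔ B⇔C = mk⇔ (map₂ (to (B⇔C _))) (map₂ (from (B⇔C _)))

Π-cong-⇔ : {A : Set} {B C : A → Set} → (∀ x → B x ⇔ C x) → (∀ x → B x) ⇔ (∀ x → C x)
Π-cong-⇔ B⇔C = mk⇔ (λ f x → to (B⇔C x) (f x)) (λ g x → from (B⇔C x) (g x))

module _ {S : Sig} (I : Interp S) where

  private
    ⟦_⟧ : Expr S → State → ℕ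
    ⟦_⟧ = Defs.⟦_⟧ I

    _⊨_ : State → Assertion S → Set
    _⊨_ = Defs._⊨_ I

    _⊨ₑ_ : Assertion S → Assertion S → Set
    _⊨ₑ_ = Defs._⊨ₑ_ I

    _；_ : Prog S → Prog S → Prog S
    _；_ = Defs._；_ S

    _[_:=_] : ∀ {n} → Assn S n → Var → Expr S → Assn S n
    _[_:=_] = Defs._[_:=_] S

  _⇓_ : Prog S × State → State → Set
  c ⇓ σ' = _⟶*_ I c (ε , σ')

  mutual
    evalT-toTerm : ∀ {n} (e : Expr S) σ (ρ : Fin n → ℕ) → evalT I (toTerm S e) σ ρ ≡ ⟦ e ⟧ σ
    evalT-toTerm (var x)    σ ρ = refl
    evalT-toTerm (num k)    σ ρ = refl
    evalT-toTerm (app f es) σ ρ = cong (funI I f) (evalTs-toTerms es σ ρ)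

    evalTs-toTerms : ∀ {n k} (es : Vec (Expr S) k) σ (ρ : Fin n → ℕ) →
                     evalTs I (toTerms S es) σ ρ ≡ ⟦_⟧* I es σ
    evalTs-toTerms []       σ ρ = refl
    evalTs-toTerms (e ∷ es) σ ρ = cong₂ _∷_ (evalT-toTerm e σ ρ) (evalTs-toTerms es σ ρ)

  sat-toAssn : ∀ {n} (B : BExp S) σ (ρ : Fin n → ℕ) → sat I σ ρ (toAssn S B) ⇔ holds I B σ
  sat-toAssn (pred q es) σ ρ = ≡⇒⇔ (cong (predI I q) (evalTs-toTerms es σ ρ))
  sat-toAssn (a == b)    σ ρ = ≡⇒⇔ (cong₂ _≡_ (evalT-toTerm a σ ρ) (evalT-toTerm b σ ρ))
  sat-toAssn (a <= b)    σ ρ = ≡⇒⇔ (cong₂ _≤_ (evalT-toTerm a σ ρ) (evalT-toTerm b σ ρ))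
  sat-toAssn (bnot B)    σ ρ = ¬-cong-⇔ (sat-toAssn B σ ρ)
  sat-toAssn (band A B)  σ ρ = sat-toAssn A σ ρ ×-⇔ sat-toAssn B σ ρ
  sat-toAssn (bor A B)   σ ρ = sat-toAssn A σ ρ ⊎-⇔ sat-toAssn B σ ρ

  mutual
    evalT-substT : ∀ {n} (t : Term S n) x E σ ρ →
                   evalT I (substT S t x E) σ ρ ≡ evalT I t (update σ x (⟦ E ⟧ σ)) ρ
    evalT-substT (fvar y) x E σ ρ with y ≟ x
    ... | yes _ = evalT-toTerm E σ ρ
    ... | no  _ = refl
    evalT-substT (bvar i)    x E σ ρ = refl
    evalT-substT (tnum k)    x E σ ρ = refl
    evalT-substT (tapp f ts) x E σ ρ = cong (funI I f) (evalTs-substTs ts x E σ ρ)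

    evalTs-substTs : ∀ {n k} (ts : Vec (Term S n) k) x E σ ρ →
                     evalTs I (substTs S ts x E) σ ρ ≡ evalTs I ts (update σ x (⟦ E ⟧ σ)) ρ
    evalTs-substTs []       x E σ ρ = refl
    evalTs-substTs (t ∷ ts) x E σ ρ = cong₂ _∷_ (evalT-substT t x E σ ρ) (evalTs-substTs ts x E σ ρ)

  sat-subst : ∀ {n} (A : Assn S n) x E σ ρ →
              sat I σ ρ (A [ x := E ]) ⇔ sat I (update σ x (⟦ E ⟧ σ)) ρ A
  sat-subst (apred q ts) x E σ ρ = ≡⇒⇔ (cong (predI I q) (evalTs-substTs ts x E σ ρ))
  sat-subst (a ≐ b)  x E σ ρ = ≡⇒⇔ (cong₂ _≡_ (evalT-substT a x E σ ρ) (evalT-substT b x E σ ρ))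
  sat-subst (a ≦ b)  x E σ ρ = ≡⇒⇔ (cong₂ _≤_ (evalT-substT a x E σ ρ) (evalT-substT b x E σ ρ))
  sat-subst (¬ₐ A)   x E σ ρ = ¬-cong-⇔ (sat-subst A x E σ ρ)
  sat-subst (A ∨ₐ B) x E σ ρ = sat-subst A x E σ ρ ⊎-⇔ sat-subst B x E σ ρ
  sat-subst (A ∧ₐ B) x E σ ρ = sat-subst A x E σ ρ ×-⇔ sat-subst B x E σ ρ
  sat-subst (A ⇒ₐ B) x E σ ρ = →-cong-⇔ (sat-subst A x E σ ρ) (sat-subst B x E σ ρ)
  sat-subst (∃ₐ A)   x E σ ρ = Σ-cong-⇔ λ v → sat-subst A x E σ (extend I ρ v)
  sat-subst (∀ₐ A)   x E σ ρ = Π-cong-⇔ λ v → sat-subst A x E σ (extend I ρ v)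

  length : ∀ {c d} → _⟶*_ I c d → ℕ
  length refl*       = zero
  length (step* _ r) = suc (length r)

  record SeqSplit (C₀ C₁ : Prog S) (σ σ' : State) (n : ℕ) : Set where
    constructor split
    field
      {mid}  : State
      first  : (C₀ , σ) ⇓ mid
      second : (C₁ , mid) ⇓ σ'
      second≤ : length second ≤ n

  seq-split : ∀ C₀ C₁ {σ σ'} (r : (C₀ ； C₁ , σ) ⇓ σ') → SeqSplit C₀ C₁ σ σ' (length r)
  seq-split ε       C₁      r = split refl* r ≤-refl
  seq-split (cmd c) ε       r = split r refl* z≤n
  seq-split (cmd c) (cmd d) (step* (step-seq {C₀' = C₀'} s) r) with seq-split C₀' (cmd d) r
  ... | split r₀ r₁ r₁≤r = split (step* s r₀) r₁ (m≤n⇒m≤1+n r₁≤r)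

  valid-axiom : ∀ Q → Valid I Q ε Q
  valid-axiom Q σ' Q-σ' .σ' refl* = Q-σ'

  valid-assign : ∀ Q {x E} → Valid I (Q [ x := E ]) (cmd (x := E)) Q
  valid-assign Q {x} {E} σ' Q-σ' σ (step* step-assign refl*) = from (sat-subst Q x E σ (noBound I)) Q-σ'

  valid-seq : ∀ {P R Q C₀ C₁} → Valid I P C₀ R → Valid I R C₁ Q → Valid I P (C₀ ； C₁) Q
  valid-seq {C₀ = C₀} {C₁} valid₀ valid₁ σ' Q-σ' σ r =
    let open SeqSplit (seq-split C₀ C₁ r) in valid₀ mid (valid₁ σ' Q-σ' mid second) σ first

  valid-cons : ∀ {P P' Q Q' C} → Valid I P C Q → P ⊨ₑ P' → Q' ⊨ₑ Q → Valid I P' C Q'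
  valid-cons valid P⊨P' Q'⊨Q σ' Q'-σ' σ r = P⊨P' σ (valid σ' (Q'⊨Q σ' Q'-σ') σ r)

  valid-or : ∀ {P Q C₀ C₁} → Valid I P C₀ Q → Valid I P C₁ Q → Valid I P (cmd (_or_ C₀ C₁)) Q
  valid-or valid₀ valid₁ σ' Q-σ' σ (step* step-or₀ r) = valid₀ σ' Q-σ' σ r
  valid-or valid₀ valid₁ σ' Q-σ' σ (step* step-or₁ r) = valid₁ σ' Q-σ' σ r

  valid-while : ∀ {B P C} → Valid I (toAssn S B ⇒ₐ P) C P →
                Valid I P (cmd (while B C)) ((¬ₐ toAssn S B) ⇒ₐ P)
  valid-while {B} {P} {C} valid σ' post σ r = go σ r (<-wellFounded (length r))
    where
    go : ∀ σ (r : (cmd (while B C) , σ) ⇓ σ') → Acc _<_ (length r) → σ ⊨ P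
    go σ (step* (step-while-false ¬b) refl*) _ = post (¬b ∘ to (sat-toAssn B σ (noBound I)))
    go σ (step* (step-while-true b) r) (acc rs) =
      let open SeqSplit (seq-split C (cmd (while B C)) r)
      in valid mid (go mid second (rs (s≤s second≤))) σ first (from (sat-toAssn B σ (noBound I)) b)

  -- Valid unfolds to a Π-type, so the assertions of a rule cannot be inferred from it.
  sound : ∀ {P C Q} → PRHL I P C Q → Valid I P C Q
  sound (axiom {Q})                      = valid-axiom Q
  sound (assign {Q})                     = valid-assign Q
  sound (seq {P} {R} {Q} d₀ d₁)          = valid-seq {P} {R} {Q} (sound d₀) (sound d₁)
  sound (cons {P} {P'} {Q} {Q'} d P⊨ ⊨Q) = valid-cons {P} {P'} {Q} {Q'} (sound d) P⊨ ⊨Q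
  sound (or {P} {Q} d₀ d₁)               = valid-or {P} {Q} (sound d₀) (sound d₁)
  sound (while {P = P} d)                = valid-while {P = P} (sound d)

proposition3p5 : (S : Sig) (I : Interp S) (P : Assertion S) (C : Prog S) (Q : Assertion S) →
    PRHL I P C Q → Valid I P C Q
proposition3p5 S I P C Q = sound I
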